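{- The number of ND-pairs in any nested SQS$(v)$ is at least $\frac{v}{2}\left(\frac{v}{2}-1\right)$.
   Context: A Steiner quadruple system SQS$(v)$ is a pair $(Q,\mathcal{B})$ where $Q$ is a set of $v$ points and $\mathcal{B}$ is a collection of 4-subsets of $Q$ (blocks) such that every 3-subset of $Q$ is contained in exactly one block. A nested SQS$(v)$ is an SQS$(v)$ together with a partition of each block into two 2-subsets (pairs). A pair of points is an ND-pair if it is one of the two pairs in the partition of at least one block. -}

module Defs where

open import Data.Nat using (ℕ; _*_; _∸_; _≤_)
open import Data.Fin using (Fin; toℕ; _<_)
open import Data.Fin.Properties using (_≟_; any?; _<?_)
open import Data.Product using (Σ; ∃; _×_; _,_)
open import Data.Sum using (_⊎_)
open import Data.List using (List; []; _∷_; length; filter; concatMap)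
open import Data.List using (allFin)
open import Relation.Binary.PropositionalEquality using (_≡_; _≢_)
open import Relation.Nullary using (Dec; ¬_)
open import Relation.Nullary.Decidable using (_×-dec_; _⊎-dec_)

-- A nested block on the point set Fin v: four distinct points a, b, c, d,
-- i.e. the block {a,b,c,d} together with its partition into the pairs
-- {a,b} and {c,d}.
record NBlock (v : ℕ) : Set where
  field
    a b c d : Fin v
    a≢b : a ≢ b
    a≢c : a ≢ c
    a≢d : a ≢ d
    b≢c : b ≢ c
    b≢d : b ≢ d
    c≢d : c ≢ d
open NBlock public

_∈B_ : ∀ {v} → Fin v → NBlock v → Set
x ∈B B = x ≡ a B ⊎ x ≡ b B ⊎ x ≡ c B ⊎ x ≡ d B

TripleIn : ∀ {v} → Fin v → Fin v → Fin v → NBlock v → Set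
TripleIn x y z B = x ∈B B × y ∈B B × z ∈B B

IsNestedSQS : (v n : ℕ) → (Fin n → NBlock v) → Set
IsNestedSQS v n blocks =
  (x y z : Fin v) → x ≢ y → x ≢ z → y ≢ z →
    Σ (Fin n) λ i → TripleIn x y z (blocks i) ×
      ((j : Fin n) → TripleIn x y z (blocks j) → j ≡ i)

SamePair : ∀ {v} → Fin v → Fin v → Fin v → Fin v → Set
SamePair x y p q = (x ≡ p × y ≡ q) ⊎ (x ≡ q × y ≡ p)

samePair? : ∀ {v} (x y p q : Fin v) → Dec (SamePair x y p q)
samePair? x y p q = ((x ≟ p) ×-dec (y ≟ q)) ⊎-dec ((x ≟ q) ×-dec (y ≟ p))

IsNDPair : ∀ {v n} → (Fin n → NBlock v) → Fin v → Fin v → Set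
IsNDPair {v} {n} blocks x y =
  ∃ λ (i : Fin n) → SamePair x y (a (blocks i)) (b (blocks i))
                  ⊎ SamePair x y (c (blocks i)) (d (blocks i))

isNDPair? : ∀ {v n} (blocks : Fin n → NBlock v) (x y : Fin v) → Dec (IsNDPair blocks x y)
isNDPair? blocks x y = any? λ i →
  samePair? x y (a (blocks i)) (b (blocks i)) ⊎-dec samePair? x y (c (blocks i)) (d (blocks i))

allPairs : (v : ℕ) → List (Fin v × Fin v)
allPairs v = filter (λ p → Data.Product.proj₁ p <? Data.Product.proj₂ p)
  (concatMap (λ x → Data.List.map (λ y → (x , y)) (allFin v)) (allFin v))

numNDPairs : ∀ {v n} → (Fin n → NBlock v) → ℕ
numNDPairs {v} blocks =
  length (filter (λ p → isNDPair? blocks (Data.Product.proj₁ p) (Data.Product.proj₂ p)) (allPairs v))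

{-# OPTIONS --safe #-}

-- Call z a partner of x when {x, z} is an ND-pair.  Suppose y ≠ x is not a
-- partner of x.  Any other non-partner z ≠ x lies with x and y in a unique
-- block, and since neither {x, y} nor {x, z} is one of its pairs, that block
-- is split as {x, w} | {y, z}.  The map z ↦ w into the partners of x is
-- injective: w determines the block through x, y, w, and z is the mate of y
-- there.  Hence x has at least (v − 2)/2 partners, and summing over x counts
-- every ND-pair twice.

module Submission where

open import Defs
open import Data.Nat using (ℕ; _*_; _∸_; _≤_)
open import Data.Fin using (Fin)

open import Data.Nat.Properties
  using ( +-*-semiring; +-identityʳ; *-identityʳ; *-assoc; +-comm; +-mono-≤; +-monoʳ-≤
        ; m≤n+o⇒m∸n≤o; module ≤-Reasoning )
open import Algebra.Properties.Semiring.Sum +-*-semiring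
  using (sum-syntax; ∑-distrib-+; ∑-comm; sum-cong-≗; sum-replicate-zero; *-distribˡ-sum)
open import Data.Bool using (true; false; if_then_else_)
open import Data.Fin using (zero; suc)
open import Data.Fin.Patterns using (0F; 1F; 2F; 3F)
open import Data.Fin.Properties using (_≟_; _<?_; all?; any?; <-cmp; <-irrefl; 0≢1+n; suc-injective)
open import Data.List using (List; []; _∷_; _++_; length; map; filter; concatMap; tabulate; allFin)
open import Data.List.Properties using (map-++; map-tabulate)
open import Data.Nat using (zero; suc; _+_; z≤n; s≤s)
open import Data.Nat.ListAction using (sum)
open import Data.Nat.ListAction.Properties using (sum-++)
open import Data.Nat.Tactic.RingSolver using (solve-∀)
open import Data.Product using (∃; _×_; _,_; proj₁; proj₂)
open import Data.Sum using (_⊎_; inj₁; inj₂)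
open import Function using (_∘_; id; Injective)
open import Relation.Binary using (Rel; Decidable; Symmetric; Irreflexive; tri<; tri≈; tri>)
open import Relation.Binary.PropositionalEquality
  using (_≡_; _≢_; refl; sym; trans; cong; cong₂; subst; module ≡-Reasoning)
open import Relation.Nullary using (Dec; yes; no; does; ¬_; ¬?; contradiction)
open import Relation.Nullary.Decidable using (_×-dec_; _→-dec_; from-yes)
open import Relation.Unary using (Pred)
import Relation.Unary as U

-- Defined through `does` so that 𝟙[ suc i ≟ suc j ] computes to 𝟙[ i ≟ j ].
𝟙[_] : ∀ {a} {A : Set a} → Dec A → ℕ
𝟙[ a? ] = if does a? then 1 else 0

module _ {a} {A : Set a} where

  𝟙-yes : (a? : Dec A) → A → 𝟙[ a? ] ≡ 1
  𝟙-yes (yes _) _ = refl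
  𝟙-yes (no ¬a) a = contradiction a ¬a

  𝟙-no : (a? : Dec A) → ¬ A → 𝟙[ a? ] ≡ 0
  𝟙-no (yes a) ¬a = contradiction a ¬a
  𝟙-no (no _) _ = refl

  𝟙-complement : (a? : Dec A) → 𝟙[ a? ] + 𝟙[ ¬? a? ] ≡ 1
  𝟙-complement (yes _) = refl
  𝟙-complement (no _) = refl

𝟙-cong : ∀ {a b} {A : Set a} {B : Set b} →
  (A → B) → (B → A) → (a? : Dec A) (b? : Dec B) → 𝟙[ a? ] ≡ 𝟙[ b? ]
𝟙-cong f g a? (yes b) = 𝟙-yes a? (g b)
𝟙-cong f g a? (no ¬b) = 𝟙-no a? (¬b ∘ f)

∑-const : ∀ n c → ∑[ i < n ] c ≡ n * c
∑-const zero c = refl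
∑-const (suc n) c = cong (c +_) (∑-const n c)

∑-mono-≤ : ∀ {n} {f g : Fin n → ℕ} → (∀ i → f i ≤ g i) →
  ∑[ i < n ] f i ≤ ∑[ i < n ] g i
∑-mono-≤ {zero} f≤g = z≤n
∑-mono-≤ {suc n} f≤g = +-mono-≤ (f≤g zero) (∑-mono-≤ (f≤g ∘ suc))

count : ∀ {n p} {P : Pred (Fin n) p} → U.Decidable P → ℕ
count {n} P? = ∑[ i < n ] 𝟙[ P? i ]

module _ {n p} {P : Pred (Fin n) p} (P? : U.Decidable P) where

  count-complement : count P? + count (¬? ∘ P?) ≡ n
  count-complement = begin
    count P? + count (¬? ∘ P?)               ≡⟨ ∑-distrib-+ (𝟙[_] ∘ P?) (𝟙[_] ∘ ¬? ∘ P?) ⟨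
    ∑[ i < n ] (𝟙[ P? i ] + 𝟙[ ¬? (P? i) ]) ≡⟨ sum-cong-≗ (𝟙-complement ∘ P?) ⟩
    ∑[ i < n ] 1                             ≡⟨ ∑-const n 1 ⟩
    n * 1                                    ≡⟨ *-identityʳ n ⟩
    n                                        ∎
    where open ≡-Reasoning

  count-none : (∀ i → ¬ P i) → count P? ≡ 0
  count-none none = trans (sum-cong-≗ (λ i → 𝟙-no (P? i) (none i))) (sum-replicate-zero n)

count-≟ : ∀ {n} (j : Fin n) → count (_≟ j) ≡ 1
count-≟ {suc n} zero = cong suc (count-none {n} (λ i → suc i ≟ zero) (λ i ()))
count-≟ (suc j) = count-≟ j

count-remove : ∀ {n p} {P : Pred (Fin n) p} (P? : U.Decidable P) {j} → P j →
  count P? ≡ 1 + count (λ i → P? i ×-dec ¬? (i ≟ j))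
count-remove {n} P? {j} pj = begin
  count P?                             ≡⟨ sum-cong-≗ split ⟩
  ∑[ i < n ] (𝟙[ P′? i ] + 𝟙[ i ≟ j ]) ≡⟨ ∑-distrib-+ (𝟙[_] ∘ P′?) (𝟙[_] ∘ (_≟ j)) ⟩
  count P′? + count (_≟ j)             ≡⟨ cong (count P′? +_) (count-≟ j) ⟩
  count P′? + 1                        ≡⟨ +-comm (count P′?) 1 ⟩
  1 + count P′?                        ∎
  where
  open ≡-Reasoning
  P′? = λ i → P? i ×-dec ¬? (i ≟ j)
  split : ∀ i → 𝟙[ P? i ] ≡ 𝟙[ P′? i ] + 𝟙[ i ≟ j ]
  split i with P? i | i ≟ j
  ... | yes _  | yes refl = refl
  ... | yes _  | no _     = refl
  ... | no ¬pi | yes refl = contradiction pj ¬pi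
  ... | no _   | no _     = refl

count-injective : ∀ {m n p q} {P : Pred (Fin m) p} {Q : Pred (Fin n) q}
  (P? : U.Decidable P) (Q? : U.Decidable Q) (f : ∀ {i} → P i → ∃ Q) →
  (∀ {i j} (p : P i) (p′ : P j) → proj₁ (f p) ≡ proj₁ (f p′) → i ≡ j) →
  count P? ≤ count Q?
count-injective {zero} P? Q? f f-inj = z≤n
count-injective {suc m} {P = P} {Q = Q} P? Q? f f-inj with P? zero
... | no _ = count-injective (P? ∘ suc) Q? f (λ p p′ → suc-injective ∘ f-inj p p′)
... | yes p₀ = begin
  1 + count (P? ∘ suc)
    ≤⟨ s≤s (count-injective (P? ∘ suc) Q′? f′ (λ p p′ → suc-injective ∘ f-inj p p′)) ⟩
  1 + count Q′?
    ≡⟨ count-remove Q? (proj₂ (f p₀)) ⟨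
  count Q?
    ∎
  where
  open ≤-Reasoning
  Q′? = λ w → Q? w ×-dec ¬? (w ≟ proj₁ (f p₀))
  f′ : ∀ {i} → P (suc i) → ∃ λ w → Q w × w ≢ proj₁ (f p₀)
  f′ p = proj₁ (f p) , proj₂ (f p) , 0≢1+n ∘ sym ∘ f-inj p p₀

handshake : ∀ {n r} {R : Rel (Fin n) r} (R? : Decidable R) → Symmetric R → Irreflexive _≡_ R →
  ∑[ x < n ] count (R? x) ≡ 2 * ∑[ x < n ] ∑[ y < n ] (𝟙[ x <? y ] * 𝟙[ R? x y ])
handshake {n} R? R-sym R-irrefl = begin
  ∑[ x < n ] ∑[ y < n ] 𝟙[ R? x y ]
    ≡⟨ sum-cong-≗ (sum-cong-≗ ∘ split) ⟩
  ∑[ x < n ] ∑[ y < n ] (below x y + below y x)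
    ≡⟨ sum-cong-≗ (λ x → ∑-distrib-+ (below x) (λ y → below y x)) ⟩
  ∑[ x < n ] (∑[ y < n ] below x y + ∑[ y < n ] below y x)
    ≡⟨ ∑-distrib-+ (λ x → ∑[ y < n ] below x y) _ ⟩
  N + ∑[ x < n ] ∑[ y < n ] below y x
    ≡⟨ cong (N +_) (∑-comm (λ x y → below y x)) ⟩
  N + N
    ≡⟨ cong (N +_) (+-identityʳ N) ⟨
  2 * N
    ∎
  where
  open ≡-Reasoning
  below : Fin n → Fin n → ℕ
  below x y = 𝟙[ x <? y ] * 𝟙[ R? x y ]
  N = ∑[ x < n ] ∑[ y < n ] below x y
  split : ∀ x y → 𝟙[ R? x y ] ≡ 𝟙[ x <? y ] * 𝟙[ R? x y ] + 𝟙[ y <? x ] * 𝟙[ R? y x ]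
  split x y with <-cmp x y
  ... | tri< x<y _ y≮x rewrite 𝟙-yes (x <? y) x<y | 𝟙-no (y <? x) y≮x =
    sym (trans (+-identityʳ _) (+-identityʳ _))
  ... | tri≈ _ refl _
    rewrite 𝟙-no (R? x x) (R-irrefl refl) | 𝟙-no (x <? x) (<-irrefl refl) = refl
  ... | tri> x≮y _ y<x rewrite 𝟙-no (x <? y) x≮y | 𝟙-yes (y <? x) y<x =
    trans (𝟙-cong R-sym R-sym (R? x y) (R? y x)) (sym (+-identityʳ _))

module _ {a} {A : Set a} where

  length-filter : ∀ {p} {P : Pred A p} (P? : U.Decidable P) xs →
    length (filter P? xs) ≡ sum (map (𝟙[_] ∘ P?) xs)
  length-filter P? [] = refl
  length-filter P? (x ∷ xs) with does (P? x)
  ... | true = cong suc (length-filter P? xs)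
  ... | false = length-filter P? xs

  sum-map-filter : ∀ {p} {P : Pred A p} (P? : U.Decidable P) (f : A → ℕ) xs →
    sum (map f (filter P? xs)) ≡ sum (map (λ x → 𝟙[ P? x ] * f x) xs)
  sum-map-filter P? f [] = refl
  sum-map-filter P? f (x ∷ xs) with does (P? x)
  ... | true = cong₂ _+_ (sym (+-identityʳ (f x))) (sum-map-filter P? f xs)
  ... | false = sum-map-filter P? f xs

  sum-map-concatMap : ∀ {b} {B : Set b} (f : B → ℕ) (g : A → List B) xs →
    sum (map f (concatMap g xs)) ≡ sum (map (sum ∘ map f ∘ g) xs)
  sum-map-concatMap f g [] = refl
  sum-map-concatMap f g (x ∷ xs) = begin
    sum (map f (g x ++ concatMap g xs))
      ≡⟨ cong sum (map-++ f (g x) (concatMap g xs)) ⟩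
    sum (map f (g x) ++ map f (concatMap g xs))
      ≡⟨ sum-++ (map f (g x)) (map f (concatMap g xs)) ⟩
    sum (map f (g x)) + sum (map f (concatMap g xs))
      ≡⟨ cong (sum (map f (g x)) +_) (sum-map-concatMap f g xs) ⟩
    sum (map f (g x)) + sum (map (sum ∘ map f ∘ g) xs)
      ∎
    where open ≡-Reasoning

  sum-map-tabulate : ∀ {n} (f : A → ℕ) (g : Fin n → A) →
    sum (map f (tabulate g)) ≡ ∑[ i < n ] f (g i)
  sum-map-tabulate {zero} f g = refl
  sum-map-tabulate {suc n} f g = cong (f (g zero) +_) (sum-map-tabulate f (g ∘ suc))

length-filter-allPairs : ∀ {v r} {R : Rel (Fin v) r} (R? : Decidable R) →
  length (filter (λ p → R? (proj₁ p) (proj₂ p)) (allPairs v))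
    ≡ ∑[ x < v ] ∑[ y < v ] (𝟙[ x <? y ] * 𝟙[ R? x y ])
length-filter-allPairs {v} R? = begin
  length (filter R′? (filter <′? (concatMap row (allFin v))))
    ≡⟨ length-filter R′? (filter <′? (concatMap row (allFin v))) ⟩
  sum (map (𝟙[_] ∘ R′?) (filter <′? (concatMap row (allFin v))))
    ≡⟨ sum-map-filter <′? (𝟙[_] ∘ R′?) (concatMap row (allFin v)) ⟩
  sum (map f (concatMap row (allFin v)))
    ≡⟨ sum-map-concatMap f row (allFin v) ⟩
  sum (map (sum ∘ map f ∘ row) (allFin v))
    ≡⟨ sum-map-tabulate (sum ∘ map f ∘ row) id ⟩
  ∑[ x < v ] sum (map f (row x))
    ≡⟨ sum-cong-≗ (λ x → cong (sum ∘ map f) (map-tabulate id (x ,_))) ⟩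
  ∑[ x < v ] sum (map f (tabulate (x ,_)))
    ≡⟨ sum-cong-≗ (λ x → sum-map-tabulate f (x ,_)) ⟩
  ∑[ x < v ] ∑[ y < v ] (𝟙[ x <? y ] * 𝟙[ R? x y ])
    ∎
  where
  open ≡-Reasoning
  R′? = λ (p : Fin v × Fin v) → R? (proj₁ p) (proj₂ p)
  <′? = λ (p : Fin v × Fin v) → proj₁ p <? proj₂ p
  f = λ p → 𝟙[ <′? p ] * 𝟙[ R′? p ]
  row = λ x → map (x ,_) (allFin v)

point : ∀ {v} → NBlock v → Fin 4 → Fin v
point B 0F = a B
point B 1F = b B
point B 2F = c B
point B 3F = d B

mate : Fin 4 → Fin 4
mate 0F = 1F
mate 1F = 0F
mate 2F = 3F
mate 3F = 2F

mate-involutive : ∀ k → mate (mate k) ≡ k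
mate-involutive 0F = refl
mate-involutive 1F = refl
mate-involutive 2F = refl
mate-involutive 3F = refl

mate-≢ : ∀ k → mate k ≢ k
mate-≢ 0F ()
mate-≢ 1F ()
mate-≢ 2F ()
mate-≢ 3F ()

mate-of-third : ∀ i j k → i ≢ j → i ≢ k → j ≢ k → mate i ≢ j → mate i ≢ k → mate j ≡ k
mate-of-third = from-yes (all? λ i → all? λ j → all? λ k →
  ¬? (i ≟ j) →-dec ¬? (i ≟ k) →-dec ¬? (j ≟ k) →-dec
  ¬? (mate i ≟ j) →-dec ¬? (mate i ≟ k) →-dec mate j ≟ k)

point-injective : ∀ {v} (B : NBlock v) → Injective _≡_ _≡_ (point B)
point-injective B {0F} {0F} _ = refl
point-injective B {0F} {1F} e = contradiction e (a≢b B)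
point-injective B {0F} {2F} e = contradiction e (a≢c B)
point-injective B {0F} {3F} e = contradiction e (a≢d B)
point-injective B {1F} {0F} e = contradiction (sym e) (a≢b B)
point-injective B {1F} {1F} _ = refl
point-injective B {1F} {2F} e = contradiction e (b≢c B)
point-injective B {1F} {3F} e = contradiction e (b≢d B)
point-injective B {2F} {0F} e = contradiction (sym e) (a≢c B)
point-injective B {2F} {1F} e = contradiction (sym e) (b≢c B)
point-injective B {2F} {2F} _ = refl
point-injective B {2F} {3F} e = contradiction e (c≢d B)
point-injective B {3F} {0F} e = contradiction (sym e) (a≢d B)
point-injective B {3F} {1F} e = contradiction (sym e) (b≢d B)
point-injective B {3F} {2F} e = contradiction (sym e) (c≢d B)
point-injective B {3F} {3F} _ = refl

point-∈B : ∀ {v} (B : NBlock v) k → point B k ∈B B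
point-∈B B 0F = inj₁ refl
point-∈B B 1F = inj₂ (inj₁ refl)
point-∈B B 2F = inj₂ (inj₂ (inj₁ refl))
point-∈B B 3F = inj₂ (inj₂ (inj₂ refl))

∈B⇒point : ∀ {v} (B : NBlock v) {x} → x ∈B B → ∃ λ k → x ≡ point B k
∈B⇒point B (inj₁ x≡a) = 0F , x≡a
∈B⇒point B (inj₂ (inj₁ x≡b)) = 1F , x≡b
∈B⇒point B (inj₂ (inj₂ (inj₁ x≡c))) = 2F , x≡c
∈B⇒point B (inj₂ (inj₂ (inj₂ x≡d))) = 3F , x≡d

record Mates {v} (B : NBlock v) (x y : Fin v) : Set where
  constructor mates
  field
    index : Fin 4
    x≡point : x ≡ point B index
    y≡point : y ≡ point B (mate index)

module _ {v} {B : NBlock v} where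

  pair⇒mates : ∀ {x y} → SamePair x y (a B) (b B) ⊎ SamePair x y (c B) (d B) → Mates B x y
  pair⇒mates (inj₁ (inj₁ (x≡a , y≡b))) = mates 0F x≡a y≡b
  pair⇒mates (inj₁ (inj₂ (x≡b , y≡a))) = mates 1F x≡b y≡a
  pair⇒mates (inj₂ (inj₁ (x≡c , y≡d))) = mates 2F x≡c y≡d
  pair⇒mates (inj₂ (inj₂ (x≡d , y≡c))) = mates 3F x≡d y≡c

  mates⇒pair : ∀ {x y} → Mates B x y → SamePair x y (a B) (b B) ⊎ SamePair x y (c B) (d B)
  mates⇒pair (mates 0F x≡a y≡b) = inj₁ (inj₁ (x≡a , y≡b))
  mates⇒pair (mates 1F x≡b y≡a) = inj₁ (inj₂ (x≡b , y≡a))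
  mates⇒pair (mates 2F x≡c y≡d) = inj₂ (inj₁ (x≡c , y≡d))
  mates⇒pair (mates 3F x≡d y≡c) = inj₂ (inj₂ (x≡d , y≡c))

  mates-sym : ∀ {x y} → Mates B x y → Mates B y x
  mates-sym (mates k refl refl) = mates (mate k) refl (cong (point B) (sym (mate-involutive k)))

  mates-≢ : ∀ {x y} → Mates B x y → x ≢ y
  mates-≢ (mates k refl refl) = mate-≢ k ∘ sym ∘ point-injective B {k} {mate k}

  mates-functional : ∀ {x y z} → Mates B x y → Mates B x z → y ≡ z
  mates-functional (mates k refl refl) (mates l x≡l refl) =
    cong (point B ∘ mate) (point-injective B {k} {l} x≡l)

  mates-∈B : ∀ {x y} → Mates B x y → x ∈B B
  mates-∈B (mates k refl _) = point-∈B B k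

  mates-tripleIn : ∀ {x y w} → Mates B x w → y ∈B B → TripleIn x y w B
  mates-tripleIn x-w y∈B = mates-∈B x-w , y∈B , mates-∈B (mates-sym x-w)

  mate-∃ : ∀ {x} → x ∈B B → ∃ (Mates B x)
  mate-∃ x∈B with k , x≡k ← ∈B⇒point B x∈B = point B (mate k) , mates k x≡k refl

  mates-of-third : ∀ {x y z} → x ∈B B → y ∈B B → z ∈B B → x ≢ y → x ≢ z → y ≢ z →
    ¬ Mates B x y → ¬ Mates B x z → Mates B y z
  mates-of-third x∈B y∈B z∈B x≢y x≢z y≢z ¬x-y ¬x-z
    with i , refl ← ∈B⇒point B x∈B
       | j , refl ← ∈B⇒point B y∈B
       | k , refl ← ∈B⇒point B z∈B =
    mates j refl (cong (point B) (sym (mate-of-third i j k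
      (x≢y ∘ cong (point B)) (x≢z ∘ cong (point B)) (y≢z ∘ cong (point B))
      (λ i↦j → ¬x-y (mates i refl (cong (point B) (sym i↦j))))
      (λ i↦k → ¬x-z (mates i refl (cong (point B) (sym i↦k)))))))

module _ {v n} (blocks : Fin n → NBlock v) where

  isNDPair-sym : Symmetric (IsNDPair blocks)
  isNDPair-sym (i , pair) = i , mates⇒pair (mates-sym (pair⇒mates {B = blocks i} pair))

  isNDPair-irrefl : Irreflexive _≡_ (IsNDPair blocks)
  isNDPair-irrefl refl (i , pair) = mates-≢ (pair⇒mates {B = blocks i} pair) refl

degree : ∀ {v n} → (Fin n → NBlock v) → Fin v → ℕ
degree blocks x = count (isNDPair? blocks x)

NonPartner : ∀ {v n} → (Fin n → NBlock v) → Fin v → Fin v → Set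
NonPartner blocks x z = ¬ IsNDPair blocks x z × z ≢ x

nonPartner? : ∀ {v n} (blocks : Fin n → NBlock v) x → U.Decidable (NonPartner blocks x)
nonPartner? blocks x z = ¬? (isNDPair? blocks x z) ×-dec ¬? (z ≟ x)

BlockPairs : ∀ {v n} → (Fin n → NBlock v) → Fin v → Fin v → Fin v → Fin v → Set
BlockPairs blocks x w y z = ∃ λ i → Mates (blocks i) x w × Mates (blocks i) y z

module _ {v n} (blocks : Fin n → NBlock v) (sqs : IsNestedSQS v n blocks) where

  block-unique : ∀ {x y z i j} → x ≢ y → x ≢ z → y ≢ z →
    TripleIn x y z (blocks i) → TripleIn x y z (blocks j) → i ≡ j
  block-unique {x} {y} {z} x≢y x≢z y≢z xyz∈i xyz∈j =
    let _ , _ , unique = sqs x y z x≢y x≢z y≢z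
    in trans (unique _ xyz∈i) (sym (unique _ xyz∈j))

  blockPairs-∃ : ∀ {x y z} → x ≢ y → ¬ IsNDPair blocks x y →
    z ≢ x → z ≢ y → ¬ IsNDPair blocks x z → ∃ λ w → BlockPairs blocks x w y z
  blockPairs-∃ {x} {y} {z} x≢y ¬x-y z≢x z≢y ¬x-z
    with i , (x∈B , y∈B , z∈B) , _ ← sqs x y z x≢y (z≢x ∘ sym) (z≢y ∘ sym)
    with w , x-w ← mate-∃ x∈B =
    w , i , x-w , mates-of-third x∈B y∈B z∈B x≢y (z≢x ∘ sym) (z≢y ∘ sym)
                    (¬x-y ∘ (i ,_) ∘ mates⇒pair) (¬x-z ∘ (i ,_) ∘ mates⇒pair)

  blockPairs-injective : ∀ {x y w z z′} → x ≢ y → ¬ IsNDPair blocks x y →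
    BlockPairs blocks x w y z → BlockPairs blocks x w y z′ → z ≡ z′
  blockPairs-injective x≢y ¬x-y (i , x-w , y-z) (j , x-w′ , y-z′) =
    mates-functional y-z (subst (λ k → Mates (blocks k) _ _) (sym i≡j) y-z′)
    where
    y≢w = λ { refl → ¬x-y (i , mates⇒pair x-w) }
    i≡j = block-unique x≢y (mates-≢ x-w) y≢w
      (mates-tripleIn x-w (mates-∈B y-z)) (mates-tripleIn x-w′ (mates-∈B y-z′))

  count-nonPartner≤1+degree : ∀ x → count (nonPartner? blocks x) ≤ 1 + degree blocks x
  count-nonPartner≤1+degree x with any? (nonPartner? blocks x)
  ... | no none rewrite count-none (nonPartner? blocks x) (λ z p → none (z , p)) = z≤n
  ... | yes (y , ¬x-y , y≢x) = begin
    count (nonPartner? blocks x)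
      ≡⟨ count-remove (nonPartner? blocks x) (¬x-y , y≢x) ⟩
    1 + count Other?
      ≤⟨ s≤s (count-injective Other? (isNDPair? blocks x) partner partner-injective) ⟩
    1 + degree blocks x
      ∎
    where
    open ≤-Reasoning
    Other? = λ z → nonPartner? blocks x z ×-dec ¬? (z ≟ y)
    x≢y = y≢x ∘ sym
    pairing : ∀ {z} → NonPartner blocks x z × z ≢ y → ∃ λ w → BlockPairs blocks x w y z
    pairing ((¬x-z , z≢x) , z≢y) = blockPairs-∃ x≢y ¬x-y z≢x z≢y ¬x-z
    partner : ∀ {z} → NonPartner blocks x z × z ≢ y → ∃ (IsNDPair blocks x)
    partner p = let w , i , x-w , _ = pairing p in w , i , mates⇒pair x-w
    partner-injective : ∀ {z z′}
      (p : NonPartner blocks x z × z ≢ y) (p′ : NonPartner blocks x z′ × z′ ≢ y) →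
      proj₁ (partner p) ≡ proj₁ (partner p′) → z ≡ z′
    partner-injective p p′ w≡w′ = blockPairs-injective x≢y ¬x-y (proj₂ (pairing p))
      (subst (λ w → BlockPairs blocks x w y _) (sym w≡w′) (proj₂ (pairing p′)))

  v∸2≤2*degree : ∀ x → v ∸ 2 ≤ 2 * degree blocks x
  v∸2≤2*degree x = m≤n+o⇒m∸n≤o v 2 (begin
    v
      ≡⟨ count-complement (isNDPair? blocks x) ⟨
    degree blocks x + count (¬? ∘ isNDPair? blocks x)
      ≡⟨ cong (degree blocks x +_) (count-remove (¬? ∘ isNDPair? blocks x) x-non-partner) ⟩
    degree blocks x + (1 + count (nonPartner? blocks x))
      ≤⟨ +-monoʳ-≤ (degree blocks x) (s≤s (count-nonPartner≤1+degree x)) ⟩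
    degree blocks x + (2 + degree blocks x)
      ≡⟨ arithmetic (degree blocks x) ⟩
    2 + 2 * degree blocks x
      ∎)
    where
    open ≤-Reasoning
    x-non-partner = isNDPair-irrefl blocks {x} refl
    arithmetic : ∀ d → d + (2 + d) ≡ 2 + 2 * d
    arithmetic = solve-∀

corollary2p5 : (v n : ℕ) (blocks : Fin n → NBlock v) →
    IsNestedSQS v n blocks →
    v * (v ∸ 2) ≤ 4 * numNDPairs blocks
corollary2p5 v n blocks sqs = begin
  v * (v ∸ 2)                      ≡⟨ ∑-const v (v ∸ 2) ⟨
  ∑[ x < v ] (v ∸ 2)               ≤⟨ ∑-mono-≤ (v∸2≤2*degree blocks sqs) ⟩
  ∑[ x < v ] (2 * degree blocks x) ≡⟨ *-distribˡ-sum 2 (degree blocks) ⟨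
  2 * ∑[ x < v ] degree blocks x   ≡⟨ cong (2 *_) degree-sum ⟩
  2 * (2 * N)                      ≡⟨ cong (λ k → 2 * (2 * k)) (length-filter-allPairs ND?) ⟨
  2 * (2 * numNDPairs blocks)      ≡⟨ *-assoc 2 2 (numNDPairs blocks) ⟨
  4 * numNDPairs blocks            ∎
  where
  open ≤-Reasoning
  ND? = isNDPair? blocks
  degree-sum = handshake ND? (isNDPair-sym blocks) (isNDPair-irrefl blocks)
  N = ∑[ x < v ] ∑[ y < v ] (𝟙[ x <? y ] * 𝟙[ ND? x y ])
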